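{- Let $a=(a_m)_{m\ge1}$ be a sequence of nonnegative integers and let $\mathbb A_1,\mathbb A_2,\dots$ be pairwise disjoint infinite alphabets of noncommuting variables. For a colored set partition $\Pi=\{[\pi_1,i_1],\dots,[\pi_k,i_k]\}$ of size $n$ associated to $a$, let $$\Phi_\Pi(\mathbb A_1,\mathbb A_2,\dots)=\sum_{\mathtt w}\mathtt w\in\mathbb C\Big\langle \bigcup_{m}\mathbb A_m\Big\rangle ,$$ the sum being over all words $\mathtt w=\mathtt a_1\cdots\mathtt a_n$ such that for every $1\le \ell\le k$ and every $j\in\pi_\ell$ one has $\mathtt a_j\in\mathbb A_{i_\ell}$, and such that $j_1,j_2\in\pi_\ell$ implies $\mathtt a_{j_1}=\mathtt a_{j_2}$. Then the linear span of the family $(\Phi_\Pi(\mathbb A_1,\mathbb A_2,\dots))_{\Pi\in\mathcal{CP}(a)}$ is a subalgebra of $\mathbb C\langle \bigcup_m\mathbb A_m\rangle$ (for the concatenation product) which is isomorphic to the algebra $\mathbf{CWSym}(a)$.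
   Context: A colored set partition of size $n$ associated to $a$ is a set of pairs $\Pi=\{[\pi_1,i_1],\dots,[\pi_k,i_k]\}$ such that $\{\pi_1,\dots,\pi_k\}$ is a set partition of $\{1,\dots,n\}$ into nonempty blocks and $1\le i_\ell\le a_{\#\pi_\ell}$ for each $\ell$ (for $n=0$ the only one is $\emptyset$). $\mathcal{CP}(a)$ denotes the set of all colored set partitions (of all sizes) associated to $a$. For $\Pi$ of size $n$ and $\Pi'$, set $\Pi\uplus\Pi'=\Pi\cup\Pi'[n]$, where $\Pi'[n]$ is obtained by adding $n$ to each integer occurring in the blocks of $\Pi'$ (colors unchanged). $\mathbf{CWSym}(a)$ is the algebra over $\mathbb C$ with basis $(\Phi_\Pi)_{\Pi\in\mathcal{CP}(a)}$ and product $\Phi_\Pi\Phi_{\Pi'}=\Phi_{\Pi\uplus\Pi'}$ (unit $\Phi_\emptyset$). -}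

module Defs where

open import Data.Nat using (ℕ; zero; suc; _+_; _≤_; _<_; _≡ᵇ_; z≤n; s≤s)
open import Data.Nat.Properties
  using (≤-refl; ≤-trans; +-monoʳ-≤; +-suc; +-identityʳ; n≤1+n; ≡ᵇ⇒≡; ≡⇒≡ᵇ; ≤∧≢⇒<; <⇒≢; ≤-reflexive; m≤m+n)
open import Data.List using (List; []; _∷_; _++_; map; length; foldr; take; drop; upTo)
open import Data.List.Properties using (length-++)
open import Data.Product using (_×_; _,_; proj₁; proj₂)
open import Data.Unit using (⊤; tt)
open import Data.Empty using (⊥-elim)
open import Data.Bool using (Bool; true; false; if_then_else_; _∧_; _∨_; not; T)
open import Relation.Binary.PropositionalEquality
open import Algebra.Bundles using (CommutativeRing)

-- A set partition of {1..n} is encoded by its restricted growth string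
-- (blocks): the j-th entry is the label of the block containing j, blocks
-- being labelled 0,1,2,... in order of their minimal elements.  This is
-- a bijection with set partitions.  colors !! b is the color i of block b,
-- required to satisfy 1 ≤ i ≤ a (#block b).

next : ℕ → ℕ → ℕ
next m x = if x ≡ᵇ m then suc m else m

RGS : ℕ → List ℕ → Set
RGS m [] = ⊤
RGS m (x ∷ xs) = (x ≤ m) × RGS (next m x) xs

nb : ℕ → List ℕ → ℕ
nb m [] = m
nb m (x ∷ xs) = nb (next m x) xs

count : ℕ → List ℕ → ℕ
count b [] = 0
count b (x ∷ xs) = if b ≡ᵇ x then suc (count b xs) else count b xs

ColorsOK : (ℕ → ℕ) → List ℕ → ℕ → List ℕ → Set
ColorsOK a bs b [] = ⊤
ColorsOK a bs b (c ∷ cs) = ((1 ≤ c) × (c ≤ a (count b bs))) × ColorsOK a bs (suc b) cs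

-- the sequence a = (a_m)_{m ≥ 1} is a : ℕ → ℕ (a 0 is never used,
-- since blocks are nonempty)
record CP (a : ℕ → ℕ) : Set where
  constructor cp
  field
    blocks : List ℕ
    colors : List ℕ
    rgs    : RGS 0 blocks
    ncol   : length colors ≡ nb 0 blocks
    colOK  : ColorsOK a blocks 0 colors

open CP public

size : ∀ {a} → CP a → ℕ
size Π = length (blocks Π)

∅ : ∀ {a} → CP a
∅ = cp [] [] tt refl tt

private
  ≡ᵇ-shift : ∀ k x m → (k + x ≡ᵇ k + m) ≡ (x ≡ᵇ m)
  ≡ᵇ-shift zero x m = refl
  ≡ᵇ-shift (suc k) x m = ≡ᵇ-shift k x m

  next-shift : ∀ k m x → next (k + m) (k + x) ≡ k + next m x
  next-shift k m x rewrite ≡ᵇ-shift k x m with x ≡ᵇ m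
  ... | true = sym (+-suc k m)
  ... | false = refl

  rgs-shift : ∀ k m xs → RGS m xs → RGS (k + m) (map (k +_) xs)
  rgs-shift k m [] r = tt
  rgs-shift k m (x ∷ xs) (x≤m , r) =
    +-monoʳ-≤ k x≤m ,
    subst (λ z → RGS z (map (k +_) xs)) (sym (next-shift k m x)) (rgs-shift k (next m x) xs r)

  nb-shift : ∀ k m xs → nb (k + m) (map (k +_) xs) ≡ k + nb m xs
  nb-shift k m [] = refl
  nb-shift k m (x ∷ xs) rewrite next-shift k m x = nb-shift k (next m x) xs

  rgs-++ : ∀ m xs ys → RGS m xs → RGS (nb m xs) ys → RGS m (xs ++ ys)
  rgs-++ m [] ys _ r = r
  rgs-++ m (x ∷ xs) ys (p , r) r' = p , rgs-++ (next m x) xs ys r r'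

  nb-++ : ∀ m xs ys → nb m (xs ++ ys) ≡ nb (nb m xs) ys
  nb-++ m [] ys = refl
  nb-++ m (x ∷ xs) ys = nb-++ (next m x) xs ys

  count-++ : ∀ b xs ys → count b (xs ++ ys) ≡ count b xs + count b ys
  count-++ b [] ys = refl
  count-++ b (x ∷ xs) ys with b ≡ᵇ x
  ... | true = cong suc (count-++ b xs ys)
  ... | false = count-++ b xs ys

  count-shift : ∀ k j ys → count (k + j) (map (k +_) ys) ≡ count j ys
  count-shift k j [] = refl
  count-shift k j (y ∷ ys) rewrite ≡ᵇ-shift k j y with j ≡ᵇ y
  ... | true = cong suc (count-shift k j ys)
  ... | false = count-shift k j ys

  ≡ᵇ-false : ∀ i x → i ≢ x → (i ≡ᵇ x) ≡ false
  ≡ᵇ-false i x ne with i ≡ᵇ x in eq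
  ... | false = refl
  ... | true = ⊥-elim (ne (≡ᵇ⇒≡ i x (subst T (sym eq) tt)))

  count-small : ∀ k j ys → j < k → count j (map (k +_) ys) ≡ 0
  count-small k j [] _ = refl
  count-small k j (y ∷ ys) j<k
    rewrite ≡ᵇ-false j (k + y) (<⇒≢ (≤-trans j<k (m≤m+n k y))) = count-small k j ys j<k

  next-≥ : ∀ m x → m ≤ next m x
  next-≥ m x with x ≡ᵇ m
  ... | true = n≤1+n m
  ... | false = ≤-refl

  nb-≥ : ∀ m xs → m ≤ nb m xs
  nb-≥ m [] = ≤-refl
  nb-≥ m (x ∷ xs) = ≤-trans (next-≥ m x) (nb-≥ (next m x) xs)

  x<next : ∀ m x → x ≤ m → x < next m x
  x<next m x x≤m with x ≡ᵇ m in eq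
  ... | true = s≤s x≤m
  ... | false = ≤∧≢⇒< x≤m (λ e → subst T eq (≡⇒≡ᵇ x m e))

  count-big : ∀ m xs i → RGS m xs → nb m xs ≤ i → count i xs ≡ 0
  count-big m [] i _ _ = refl
  count-big m (x ∷ xs) i (x≤m , r) p
    rewrite ≡ᵇ-false i x (λ e → <⇒≢ (≤-trans (x<next m x x≤m) (≤-trans (nb-≥ (next m x) xs) p)) (sym e))
    = count-big (next m x) xs i r p

  colors-mono : ∀ a X Z b cs → (∀ j → j < b + length cs → count j Z ≡ count j X) →
                ColorsOK a X b cs → ColorsOK a Z b cs
  colors-mono a X Z b [] f _ = tt
  colors-mono a X Z b (c ∷ cs) f ((p , q) , r) =
    (p , subst (λ z → c ≤ a z) (sym (f b (subst (b <_) (sym (+-suc b (length cs))) (s≤s (m≤m+n b (length cs)))))) q) ,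
    colors-mono a X Z (suc b) cs (λ j lt → f j (subst (j <_) (sym (+-suc b (length cs))) lt)) r

  colors-shift : ∀ a Y Z k b cs → (∀ j → count (k + j) Z ≡ count j Y) →
                 ColorsOK a Y b cs → ColorsOK a Z (k + b) cs
  colors-shift a Y Z k b [] f _ = tt
  colors-shift a Y Z k b (c ∷ cs) f ((p , q) , r) =
    (p , subst (λ z → c ≤ a z) (sym (f b)) q) ,
    subst (λ z → ColorsOK a Z z cs) (+-suc k b) (colors-shift a Y Z k (suc b) cs f r)

-- Π ⊎ Π' = Π ∪ Π'[n]: in the canonical encoding the labels of the blocks
-- of Π' are shifted by the number of blocks of Π, colors are kept.

_⊎_ : ∀ {a} → CP a → CP a → CP a
_⊎_ {a} (cp bs cs r nc ok) (cp bs' cs' r' nc' ok') =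
  cp (bs ++ map (k +_) bs') (cs ++ cs') rgs′ ncol′ ok″
  where
  k = nb 0 bs
  shR : RGS (k + 0) (map (k +_) bs')
  shR = rgs-shift k 0 bs' r'
  rgs′ : RGS 0 (bs ++ map (k +_) bs')
  rgs′ = rgs-++ 0 bs (map (k +_) bs') r
           (subst (λ z → RGS z (map (k +_) bs')) (+-identityʳ k) shR)
  nbEq : nb 0 (bs ++ map (k +_) bs') ≡ k + nb 0 bs'
  nbEq = trans (nb-++ 0 bs (map (k +_) bs'))
           (trans (cong (λ z → nb z (map (k +_) bs')) (sym (+-identityʳ k)))
                  (nb-shift k 0 bs'))
  ncol′ : length (cs ++ cs') ≡ nb 0 (bs ++ map (k +_) bs')
  ncol′ = trans (length-++ cs) (trans (cong₂ _+_ nc nc') (sym nbEq))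
  Z = bs ++ map (k +_) bs'
  ok1 : ColorsOK a Z 0 cs
  ok1 = colors-mono a bs Z 0 cs f ok
    where
    f : ∀ j → j < length cs → count j Z ≡ count j bs
    f j lt = trans (count-++ j bs (map (k +_) bs'))
               (trans (cong (count j bs +_) (count-small k j bs' (subst (j <_) nc lt)))
                      (+-identityʳ _))
  ok2 : ColorsOK a Z (k + 0) cs'
  ok2 = colors-shift a bs' Z k 0 cs' g ok'
    where
    g : ∀ j → count (k + j) Z ≡ count j bs'
    g j = trans (count-++ (k + j) bs (map (k +_) bs'))
            (trans (cong (_+ count (k + j) (map (k +_) bs'))
                         (count-big 0 bs (k + j) r (m≤m+n k j)))
                   (count-shift k j bs'))
  ok-++ : ∀ X b xs ys → ColorsOK a X b xs → ColorsOK a X (b + length xs) ys →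
          ColorsOK a X b (xs ++ ys)
  ok-++ X b [] ys _ q = subst (λ z → ColorsOK a X z ys) (+-identityʳ b) q
  ok-++ X b (x ∷ xs) ys (p , ps) q =
    p , ok-++ X (suc b) xs ys ps (subst (λ z → ColorsOK a X z ys) (+-suc b (length xs)) q)
  ok″ : ColorsOK a Z 0 (cs ++ cs')
  ok″ = ok-++ Z 0 cs cs' ok1
          (subst (λ z → ColorsOK a Z z cs') (trans (+-identityʳ k) (sym nc)) ok2)

-- A letter (m , x) is the x-th letter of the alphabet 𝔸_{m+1}; each
-- alphabet is infinite (countable) and they are pairwise disjoint.
-- A (formal) series is its coefficient function on words.  Φ_Π(𝔸) is an
-- infinite sum of words, so it lives in the series algebra, whose product
-- (extending concatenation) is the usual finite sum over factorisations.

Letter : Set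
Letter = ℕ × ℕ

Word : Set
Word = List Letter

letterEq : Letter → Letter → Bool
letterEq (m , x) (m' , x') = (m ≡ᵇ m') ∧ (x ≡ᵇ x')

-- b-th element of a list (default 0, never used for valid data)
nth : List ℕ → ℕ → ℕ
nth [] _ = 0
nth (c ∷ cs) zero = c
nth (c ∷ cs) (suc b) = nth cs b

zipBW : List ℕ → Word → Bool × List (ℕ × Letter)
zipBW [] [] = true , []
zipBW (b ∷ bs) (l ∷ ls) = proj₁ (zipBW bs ls) , ((b , l) ∷ proj₂ (zipBW bs ls))
zipBW [] (_ ∷ _) = false , []
zipBW (_ ∷ _) [] = false , []

allB : ∀ {A : Set} → (A → Bool) → List A → Bool
allB p [] = true
allB p (x ∷ xs) = p x ∧ allB p xs

occurs : List ℕ → List ℕ → Word → Bool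
occurs bs cs w =
  let z = zipBW bs w ; ps = proj₂ z in
  proj₁ z
  ∧ allB (λ { (b , (m , x)) → nth cs b ≡ᵇ suc m }) ps
  ∧ allB (λ { (b , l) → allB (λ { (b' , l') → not (b ≡ᵇ b') ∨ letterEq l l' }) ps }) ps

listEq : List ℕ → List ℕ → Bool
listEq [] [] = true
listEq (x ∷ xs) (y ∷ ys) = (x ≡ᵇ y) ∧ listEq xs ys
listEq _ _ = false

sameCP : ∀ {a} → CP a → CP a → Bool
sameCP Π Π' = listEq (blocks Π) (blocks Π') ∧ listEq (colors Π) (colors Π')

module WithRing {c ℓ} (R : CommutativeRing c ℓ) where
  open CommutativeRing R public using (_≈_; 0#; 1#)
  open CommutativeRing R using (Carrier) renaming (_+_ to _+ᴿ_; _*_ to _*ᴿ_)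

  Series : Set c
  Series = Word → Carrier

  sumR : List Carrier → Carrier
  sumR = foldr _+ᴿ_ 0#

  _*ˢ_ : Series → Series → Series
  (f *ˢ g) w = sumR (map (λ i → f (take i w) *ᴿ g (drop i w)) (upTo (suc (length w))))

  1ˢ : Series
  1ˢ [] = 1#
  1ˢ (_ ∷ _) = 0#

  Φ : ∀ {a} → CP a → Series
  Φ Π w = if occurs (blocks Π) (colors Π) w then 1# else 0#

  CWSym : (ℕ → ℕ) → Set c
  CWSym a = List (Carrier × CP a)

  coeff : ∀ {a} → CWSym a → CP a → Carrier
  coeff [] Π = 0#
  coeff ((r , Π') ∷ xs) Π = (if sameCP Π' Π then r else 0#) +ᴿ coeff xs Π

  eval : ∀ {a} → CWSym a → Series
  eval [] w = 0#
  eval ((r , Π) ∷ xs) w = r *ᴿ Φ Π w +ᴿ eval xs w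

-- A word w = u v factors with |u| = size Π in exactly one way, and the
-- conditions that Π ⊎ Π′ imposes on u v are those of Π on u together with
-- those of Π′ on v; hence Φ_Π Φ_Π′ = Φ_{Π ⊎ Π′}.
--
-- For linear independence, evaluate at the canonical word of Π, which gives
-- each block its own letter from the alphabet of its colour.  It occurs in
-- Φ_Π, and it occurs in Φ_Π′ only if Π′ = Π or the blocks of Π′ strictly
-- refine those of Π.  On restricted growth strings refinement raises the
-- labels pointwise, so it lowers the slack Σ_j (j − b_j).  The family is thus
-- unitriangular, and the coefficients of a vanishing combination vanish by
-- induction on the slack.

module Submission where

open import Defs
open import Algebra.Bundles using (CommutativeRing; CommutativeMonoid)
open import Data.Bool using (Bool; true; false; T; _∧_; _∨_; not; if_then_else_)
open import Data.Bool.Properties using (∧-assoc; ∧-identityʳ; ∧-zeroʳ; ∧-commutativeMonoid)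
open import Data.Empty using (⊥-elim)
open import Data.List using (List; []; _∷_; _++_; map; length; take; drop; zip; applyUpTo)
open import Data.List.Membership.Propositional using (_∈_)
open import Data.List.Membership.Propositional.Properties using (∈-map⁺; ∈-map⁻)
open import Data.List.Properties using (length-map; length-++; length-take; map-applyUpTo; take++drop≡id)
open import Data.List.Relation.Binary.Pointwise using (Pointwise; []; _∷_)
open import Data.List.Relation.Unary.Any using (here; there)
open import Data.Nat using (ℕ; zero; suc; _+_; _∸_; _≤_; _<_; _≡ᵇ_; _≤?_; z≤n; s≤s)
open import Data.Nat.Induction using (<-wellFounded)
open import Data.Nat.Properties
  using (≤-refl; ≤-trans; ≤-reflexive; <-≤-trans; ≤-<-trans; n≤1+n; m≤m+n; <⇒≢; <-irrefl; ≤-pred;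
         suc-injective; ≡ᵇ⇒≡; m≤n⇒m<n∨m≡n; m≤n⇒m⊓n≡m; ∸-monoʳ-<; ∸-monoʳ-≤;
         +-mono-≤-<; +-mono-<-≤)
open import Data.Product using (_×_; _,_; proj₁; proj₂; ∃; map₁; map₂)
open import Data.Sum using (inj₁; inj₂) renaming (_⊎_ to _⊎′_)
open import Data.Unit using (⊤; tt)
open import Function using (id)
open import Induction.WellFounded using (module All)
open import Relation.Binary.Construct.On using () renaming (wellFounded to wellFounded-on)
open import Relation.Binary.PropositionalEquality
  using (_≡_; _≢_; refl; sym; trans; cong; cong₂; subst; ≢-sym; module ≡-Reasoning)
open import Relation.Nullary using (yes; no)

import Algebra.Properties.CommutativeSemigroup as CommutativeSemigroupProperties
import Relation.Binary.Reasoning.Setoid as SetoidReasoning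

module ∧ = CommutativeSemigroupProperties (CommutativeMonoid.commutativeSemigroup ∧-commutativeMonoid)

≡ᵇ-refl : ∀ n → (n ≡ᵇ n) ≡ true
≡ᵇ-refl zero = refl
≡ᵇ-refl (suc n) = ≡ᵇ-refl n

≡ᵇ-comm : ∀ m n → (m ≡ᵇ n) ≡ (n ≡ᵇ m)
≡ᵇ-comm zero zero = refl
≡ᵇ-comm zero (suc n) = refl
≡ᵇ-comm (suc m) zero = refl
≡ᵇ-comm (suc m) (suc n) = ≡ᵇ-comm m n

≡ᵇ-true⇒≡ : ∀ m n → (m ≡ᵇ n) ≡ true → m ≡ n
≡ᵇ-true⇒≡ m n e = ≡ᵇ⇒≡ m n (subst T (sym e) tt)

≢⇒≡ᵇ-false : ∀ m n → m ≢ n → (m ≡ᵇ n) ≡ false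
≢⇒≡ᵇ-false m n m≢n with m ≡ᵇ n in e
... | false = refl
... | true = ⊥-elim (m≢n (≡ᵇ-true⇒≡ m n e))

+-cancelˡ-≡ᵇ : ∀ k m n → (k + m ≡ᵇ k + n) ≡ (m ≡ᵇ n)
+-cancelˡ-≡ᵇ zero m n = refl
+-cancelˡ-≡ᵇ (suc k) m n = +-cancelˡ-≡ᵇ k m n

∧-true⇒ˡ : ∀ {a b} → a ∧ b ≡ true → a ≡ true
∧-true⇒ˡ {true} _ = refl

∧-true⇒ʳ : ∀ {a b} → a ∧ b ≡ true → b ≡ true
∧-true⇒ʳ {true} e = e

not-true⇒false : ∀ {a} → not a ≡ true → a ≡ false
not-true⇒false {false} _ = refl

listEq-refl : ∀ xs → listEq xs xs ≡ true
listEq-refl [] = refl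
listEq-refl (x ∷ xs) rewrite ≡ᵇ-refl x = listEq-refl xs

listEq-comm : ∀ xs ys → listEq xs ys ≡ listEq ys xs
listEq-comm [] [] = refl
listEq-comm [] (y ∷ ys) = refl
listEq-comm (x ∷ xs) [] = refl
listEq-comm (x ∷ xs) (y ∷ ys) = cong₂ _∧_ (≡ᵇ-comm x y) (listEq-comm xs ys)

listEq⇒≡ : ∀ xs ys → listEq xs ys ≡ true → xs ≡ ys
listEq⇒≡ [] [] _ = refl
listEq⇒≡ (x ∷ xs) (y ∷ ys) e =
  cong₂ _∷_ (≡ᵇ-true⇒≡ x y (∧-true⇒ˡ e)) (listEq⇒≡ xs ys (∧-true⇒ʳ e))

letterEq-refl : ∀ l → letterEq l l ≡ true
letterEq-refl (m , x) rewrite ≡ᵇ-refl m | ≡ᵇ-refl x = refl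

suc[n∸1]≡n : ∀ {n} → 1 ≤ n → suc (n ∸ 1) ≡ n
suc[n∸1]≡n (s≤s _) = refl

module _ {A : Set} where

  allB-++ : (p : A → Bool) (xs ys : List A) → allB p (xs ++ ys) ≡ allB p xs ∧ allB p ys
  allB-++ p [] ys = refl
  allB-++ p (x ∷ xs) ys = trans (cong (p x ∧_) (allB-++ p xs ys)) (sym (∧-assoc (p x) _ _))

  allB-cong : ∀ {p q : A → Bool} xs → (∀ {x} → x ∈ xs → p x ≡ q x) → allB p xs ≡ allB q xs
  allB-cong [] _ = refl
  allB-cong (x ∷ xs) p≡q = cong₂ _∧_ (p≡q (here refl)) (allB-cong xs (λ x∈ → p≡q (there x∈)))

  allB⁺ : ∀ {p : A → Bool} {xs} → (∀ {x} → x ∈ xs → p x ≡ true) → allB p xs ≡ true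
  allB⁺ {xs = []} _ = refl
  allB⁺ {xs = x ∷ xs} px rewrite px (here refl) = allB⁺ (λ x∈ → px (there x∈))

  allB⁻ : ∀ {p : A → Bool} {xs x} → allB p xs ≡ true → x ∈ xs → p x ≡ true
  allB⁻ e (here refl) = ∧-true⇒ˡ e
  allB⁻ e (there x∈) = allB⁻ (∧-true⇒ʳ e) x∈

  allB² : (A → A → Bool) → List A → Bool
  allB² r xs = allB (λ x → allB (r x) xs) xs

  allB²⁺ : ∀ {r : A → A → Bool} {xs} → (∀ {x y} → x ∈ xs → y ∈ xs → r x y ≡ true) →
           allB² r xs ≡ true
  allB²⁺ rxy = allB⁺ (λ x∈ → allB⁺ (rxy x∈))

  allB²⁻ : ∀ {r : A → A → Bool} {xs x y} → allB² r xs ≡ true →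
           x ∈ xs → y ∈ xs → r x y ≡ true
  allB²⁻ e x∈ y∈ = allB⁻ (allB⁻ e x∈) y∈

  allB²-++ : ∀ (r : A → A → Bool) xs ys →
             (∀ {x y} → x ∈ xs → y ∈ ys → r x y ≡ true × r y x ≡ true) →
             allB² r (xs ++ ys) ≡ allB² r xs ∧ allB² r ys
  allB²-++ r xs ys cross =
    trans (allB-++ _ xs ys) (cong₂ _∧_ (allB-cong xs onLeft) (allB-cong ys onRight))
    where
    onLeft : ∀ {x} → x ∈ xs → allB (r x) (xs ++ ys) ≡ allB (r x) xs
    onLeft {x} x∈ = trans (allB-++ (r x) xs ys)
      (trans (cong (allB (r x) xs ∧_) (allB⁺ (λ y∈ → proj₁ (cross x∈ y∈)))) (∧-identityʳ _))
    onRight : ∀ {y} → y ∈ ys → allB (r y) (xs ++ ys) ≡ allB (r y) ys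
    onRight {y} y∈ = trans (allB-++ (r y) xs ys)
      (cong (_∧ allB (r y) ys) (allB⁺ (λ x∈ → proj₂ (cross x∈ y∈))))

module _ {A B : Set} where

  allB-map : (p : B → Bool) (f : A → B) (xs : List A) → allB p (map f xs) ≡ allB (λ x → p (f x)) xs
  allB-map p f [] = refl
  allB-map p f (x ∷ xs) = cong (p (f x) ∧_) (allB-map p f xs)

  allB²-map : ∀ {r : B → B → Bool} {r′ : A → A → Bool} (f : A → B) xs →
              (∀ x y → r (f x) (f y) ≡ r′ x y) → allB² r (map f xs) ≡ allB² r′ xs
  allB²-map {r} f xs r∘f≡r′ =
    trans (allB-map _ f xs) (allB-cong xs (λ {x} _ →
      trans (allB-map (r (f x)) f xs) (allB-cong xs (λ {y} _ → r∘f≡r′ x y))))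

  zip-++ : ∀ (xs : List A) (us : List B) {ys vs} → length xs ≡ length us →
           zip (xs ++ ys) (us ++ vs) ≡ zip xs us ++ zip ys vs
  zip-++ [] [] _ = refl
  zip-++ (x ∷ xs) (u ∷ us) len = cong ((x , u) ∷_) (zip-++ xs us (suc-injective len))

  ∈-zip⁻ˡ : ∀ {xs : List A} {ys : List B} {x y} → (x , y) ∈ zip xs ys → x ∈ xs
  ∈-zip⁻ˡ {_ ∷ _} {_ ∷ _} (here refl) = here refl
  ∈-zip⁻ˡ {_ ∷ _} {_ ∷ _} (there p∈) = there (∈-zip⁻ˡ p∈)

module _ {A B C : Set} where

  zip-mapˡ : ∀ (f : A → C) (xs : List A) (ys : List B) → zip (map f xs) ys ≡ map (map₁ f) (zip xs ys)
  zip-mapˡ f [] ys = refl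
  zip-mapˡ f (x ∷ xs) [] = refl
  zip-mapˡ f (x ∷ xs) (y ∷ ys) = cong ((f x , y) ∷_) (zip-mapˡ f xs ys)

  zip-mapʳ : ∀ (f : B → C) (xs : List A) (ys : List B) → zip xs (map f ys) ≡ map (map₂ f) (zip xs ys)
  zip-mapʳ f [] ys = refl
  zip-mapʳ f (x ∷ xs) [] = refl
  zip-mapʳ f (x ∷ xs) (y ∷ ys) = cong ((x , f y) ∷_) (zip-mapʳ f xs ys)

module _ {A : Set} where

  ∈-zip-diag⁺ : ∀ {xs : List A} {x} → x ∈ xs → (x , x) ∈ zip xs xs
  ∈-zip-diag⁺ (here refl) = here refl
  ∈-zip-diag⁺ (there x∈) = there (∈-zip-diag⁺ x∈)

  ∈-zip-diag⁻ : ∀ {xs : List A} {x y} → (x , y) ∈ zip xs xs → x ≡ y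
  ∈-zip-diag⁻ {_ ∷ _} (here refl) = refl
  ∈-zip-diag⁻ {_ ∷ _} (there p∈) = ∈-zip-diag⁻ p∈

nth-++ˡ : ∀ cs cs′ {b} → b < length cs → nth (cs ++ cs′) b ≡ nth cs b
nth-++ˡ (c ∷ cs) cs′ {zero} _ = refl
nth-++ˡ (c ∷ cs) cs′ {suc b} (s≤s b<) = nth-++ˡ cs cs′ b<

nth-++ʳ : ∀ cs cs′ b → nth (cs ++ cs′) (length cs + b) ≡ nth cs′ b
nth-++ʳ [] cs′ b = refl
nth-++ʳ (c ∷ cs) cs′ b = nth-++ʳ cs cs′ b

length-take-≤ : ∀ {A : Set} {i} {xs : List A} → i ≤ length xs → length (take i xs) ≡ i
length-take-≤ {i = i} {xs} i≤ = trans (length-take i xs) (m≤n⇒m⊓n≡m i≤)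

nth-ext : ∀ cs cs′ → length cs′ ≡ length cs → (∀ b → b < length cs → nth cs′ b ≡ nth cs b) →
          cs′ ≡ cs
nth-ext [] [] _ _ = refl
nth-ext (c ∷ cs) (c′ ∷ cs′) len agree =
  cong₂ _∷_ (agree 0 (s≤s z≤n)) (nth-ext cs cs′ (suc-injective len) (λ b b< → agree (suc b) (s≤s b<)))

next-≤ : ∀ m x → next m x ≤ suc m
next-≤ m x with x ≡ᵇ m
... | true = ≤-refl
... | false = n≤1+n m

next-self : ∀ m → next m m ≡ suc m
next-self m rewrite ≡ᵇ-refl m = refl

next-< : ∀ {m x} → x < m → next m x ≡ m
next-< {m} {x} x<m rewrite ≢⇒≡ᵇ-false x m (<⇒≢ x<m) = refl

next-≥ : ∀ m x → m ≤ next m x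
next-≥ m x with x ≡ᵇ m
... | true = n≤1+n m
... | false = ≤-refl

<-next : ∀ {m x} → x ≤ m → x < next m x
<-next {m} {x} x≤m with m≤n⇒m<n∨m≡n x≤m
... | inj₁ x<m = subst (x <_) (sym (next-< x<m)) x<m
... | inj₂ refl = subst (m <_) (sym (next-self m)) ≤-refl

nb-≥ : ∀ m xs → m ≤ nb m xs
nb-≥ m [] = ≤-refl
nb-≥ m (x ∷ xs) = ≤-trans (next-≥ m x) (nb-≥ (next m x) xs)

RGS-label<nb : ∀ {m xs x} → RGS m xs → x ∈ xs → x < nb m xs
RGS-label<nb {m} {y ∷ xs} (y≤m , _) (here refl) = ≤-trans (<-next y≤m) (nb-≥ (next m y) xs)
RGS-label<nb (_ , r) (there x∈) = RGS-label<nb r x∈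

RGS-covers : ∀ {m xs b} → RGS m xs → m ≤ b → b < nb m xs → b ∈ xs
RGS-covers {m} {[]} _ m≤b b<m = ⊥-elim (<-irrefl refl (≤-<-trans m≤b b<m))
RGS-covers {m} {x ∷ xs} {b} (x≤m , r) m≤b b<nb with m≤n⇒m<n∨m≡n x≤m
... | inj₁ x<m = there (RGS-covers r (subst (_≤ b) (sym (next-< x<m)) m≤b) b<nb)
... | inj₂ refl with m≤n⇒m<n∨m≡n m≤b
...   | inj₂ refl = here refl
...   | inj₁ x<b = there (RGS-covers r (subst (_≤ b) (sym (next-self x)) x<b) b<nb)

BoundedFrom : ℕ → List ℕ → Set
BoundedFrom k [] = ⊤
BoundedFrom k (x ∷ xs) = x ≤ k × BoundedFrom (suc k) xs

RGS⇒BoundedFrom : ∀ {m k xs} → RGS m xs → m ≤ k → BoundedFrom k xs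
RGS⇒BoundedFrom {xs = []} _ _ = tt
RGS⇒BoundedFrom {m} {k} {x ∷ xs} (x≤m , r) m≤k =
  ≤-trans x≤m m≤k , RGS⇒BoundedFrom r (≤-trans (next-≤ m x) (s≤s m≤k))

slack : ℕ → List ℕ → ℕ
slack k [] = 0
slack k (x ∷ xs) = (k ∸ x) + slack (suc k) xs

slack-< : ∀ k {xs ys} → BoundedFrom k ys → Pointwise _≤_ xs ys → xs ≡ ys ⊎′ slack k ys < slack k xs
slack-< k _ [] = inj₁ refl
slack-< k (y≤k , bounded) (x≤y ∷ xs≤ys) with slack-< (suc k) bounded xs≤ys | m≤n⇒m<n∨m≡n x≤y
... | inj₁ refl | inj₂ refl = inj₁ refl
... | inj₂ tail< | inj₂ refl = inj₂ (+-mono-≤-< ≤-refl tail<)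
... | inj₁ refl | inj₁ x<y = inj₂ (+-mono-<-≤ (∸-monoʳ-< x<y y≤k) ≤-refl)
... | inj₂ tail< | inj₁ _ = inj₂ (+-mono-≤-< (∸-monoʳ-≤ k x≤y) tail<)

Functional : List (ℕ × ℕ) → Set
Functional W = ∀ {x y z} → (x , y) ∈ W → (x , z) ∈ W → y ≡ z

next-≤-bound : ∀ {m n y} → y ≤ m → y < n → m ≤ n → next m y ≤ n
next-≤-bound {m} y≤m y<n m≤n with m≤n⇒m<n∨m≡n y≤m
... | inj₁ y<m = subst (_≤ _) (sym (next-< y<m)) m≤n
... | inj₂ refl = subst (_≤ _) (sym (next-self m)) y<n

-- Functionality says that the blocks of xs refine those of ys.  Reading left
-- to right, a new block of xs opens at its label n, where ys has used at most
-- n labels so far.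
functional⇒pointwise-≤ : ∀ {xs ys} → RGS 0 xs → RGS 0 ys → length xs ≡ length ys →
                          Functional (zip xs ys) → Pointwise _≤_ ys xs
functional⇒pointwise-≤ {xs} {ys} rx ry len functional = go rx ry z≤n (λ _ ()) len id
  where
  go : ∀ {xs′ ys′ m n} → RGS n xs′ → RGS m ys′ → m ≤ n →
       (∀ x → x < n → ∃ λ y → (x , y) ∈ zip xs ys × y ≤ x) → length xs′ ≡ length ys′ →
       (∀ {p} → p ∈ zip xs′ ys′ → p ∈ zip xs ys) → Pointwise _≤_ ys′ xs′
  go {[]} {[]} _ _ _ _ _ _ = []
  go {x ∷ xs′} {y ∷ ys′} {m} {n} (x≤n , rx′) (y≤m , ry′) m≤n seen len sub
    with m≤n⇒m<n∨m≡n x≤n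
  ... | inj₁ x<n =
    let (y₀ , x↦y₀ , y₀≤x) = seen x x<n
        y≤x = subst (_≤ x) (sym (functional (sub (here refl)) x↦y₀)) y₀≤x
    in y≤x ∷ go (subst (λ k → RGS k xs′) (next-< x<n) rx′) ry′
                (next-≤-bound y≤m (≤-<-trans y≤x x<n) m≤n)
                seen (suc-injective len) (λ p∈ → sub (there p∈))
  ... | inj₂ refl =
    ≤-trans y≤m m≤n ∷ go (subst (λ k → RGS k xs′) (next-self x) rx′) ry′
                         (≤-trans (next-≤ m y) (s≤s m≤n))
                         seen′ (suc-injective len) (λ p∈ → sub (there p∈))
    where
    seen′ : ∀ x′ → x′ < suc x → ∃ λ y′ → (x′ , y′) ∈ zip xs ys × y′ ≤ x′
    seen′ x′ x′<sx with m≤n⇒m<n∨m≡n (≤-pred x′<sx)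
    ... | inj₁ x′<x = seen x′ x′<x
    ... | inj₂ refl = y , sub (here refl) , ≤-trans y≤m m≤n

colourMatches : List ℕ → ℕ × Letter → Bool
colourMatches cs (b , (m , _)) = nth cs b ≡ᵇ suc m

consistent : ℕ × Letter → ℕ × Letter → Bool
consistent (b , l) (b′ , l′) = not (b ≡ᵇ b′) ∨ letterEq l l′

occursPairs : List ℕ → List (ℕ × Letter) → Bool
occursPairs cs ps = allB (colourMatches cs) ps ∧ allB² consistent ps

zipBW≡ : ∀ bs (w : Word) → zipBW bs w ≡ ((length bs ≡ᵇ length w) , zip bs w)
zipBW≡ [] [] = refl
zipBW≡ [] (_ ∷ _) = refl
zipBW≡ (_ ∷ _) [] = refl
zipBW≡ (b ∷ bs) (l ∷ w) rewrite zipBW≡ bs w = refl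

occurs≡ : ∀ bs cs w → occurs bs cs w ≡ (length bs ≡ᵇ length w) ∧ occursPairs cs (zip bs w)
occurs≡ bs cs w = cong (λ z → proj₁ z ∧ occursPairs cs (proj₂ z)) (zipBW≡ bs w)

occurs⇒length≡ : ∀ bs cs w → occurs bs cs w ≡ true → length bs ≡ length w
occurs⇒length≡ bs cs w e = ≡ᵇ-true⇒≡ _ _ (∧-true⇒ˡ (trans (sym (occurs≡ bs cs w)) e))

length≢⇒occurs≡false : ∀ bs cs w → length bs ≢ length w → occurs bs cs w ≡ false
length≢⇒occurs≡false bs cs w ne =
  trans (occurs≡ bs cs w) (cong (_∧ occursPairs cs (zip bs w)) (≢⇒≡ᵇ-false _ _ ne))

length≡⇒occurs≡occursPairs : ∀ bs cs w → length bs ≡ length w →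
                             occurs bs cs w ≡ occursPairs cs (zip bs w)
length≡⇒occurs≡occursPairs bs cs w len rewrite occurs≡ bs cs w | len | ≡ᵇ-refl (length w) = refl

shiftBlock : ℕ → ℕ × Letter → ℕ × Letter
shiftBlock k = map₁ (k +_)

consistent-shift : ∀ k p q → consistent (shiftBlock k p) (shiftBlock k q) ≡ consistent p q
consistent-shift k (b , _) (b′ , _) rewrite +-cancelˡ-≡ᵇ k b b′ = refl

consistent-apart : ∀ p q → proj₁ p ≢ proj₁ q → consistent p q ≡ true
consistent-apart (b , _) (b′ , _) b≢b′ rewrite ≢⇒≡ᵇ-false b b′ b≢b′ = refl

-- Pairs of ps and of the shifted qs lie in different blocks, so the
-- consistency conditions do not interact.
occursPairs-++ : ∀ cs cs′ ps qs → (∀ {p} → p ∈ ps → proj₁ p < length cs) →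
                 occursPairs (cs ++ cs′) (ps ++ map (shiftBlock (length cs)) qs) ≡
                 occursPairs cs ps ∧ occursPairs cs′ qs
occursPairs-++ cs cs′ ps qs ps<k =
  trans (cong₂ _∧_ colours consistency)
        (∧.interchange (allB (colourMatches cs) ps) (allB (colourMatches cs′) qs)
                       (allB² consistent ps) (allB² consistent qs))
  where
  k = length cs
  qs′ = map (shiftBlock k) qs
  colours : allB (colourMatches (cs ++ cs′)) (ps ++ qs′) ≡
            allB (colourMatches cs) ps ∧ allB (colourMatches cs′) qs
  colours = trans (allB-++ _ ps qs′) (cong₂ _∧_
    (allB-cong ps (λ {p} p∈ → cong (_≡ᵇ suc (proj₁ (proj₂ p))) (nth-++ˡ cs cs′ (ps<k p∈))))
    (trans (allB-map _ _ qs)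
           (allB-cong qs (λ {q} _ → cong (_≡ᵇ suc (proj₁ (proj₂ q))) (nth-++ʳ cs cs′ (proj₁ q))))))
  apart : ∀ {p q} → p ∈ ps → q ∈ qs′ → proj₁ p ≢ proj₁ q
  apart p∈ q∈ with ∈-map⁻ (shiftBlock k) q∈
  ... | (q₀ , _ , refl) = <⇒≢ (<-≤-trans (ps<k p∈) (m≤m+n k (proj₁ q₀)))
  consistency : allB² consistent (ps ++ qs′) ≡ allB² consistent ps ∧ allB² consistent qs
  consistency = trans
    (allB²-++ consistent ps qs′ (λ {p} {q} p∈ q∈ →
      consistent-apart p q (apart p∈ q∈) , consistent-apart q p (≢-sym (apart p∈ q∈))))
    (cong (allB² consistent ps ∧_) (allB²-map (shiftBlock k) qs (consistent-shift k)))

occurs-++ : ∀ {bs cs} bs′ cs′ (u v : Word) → RGS 0 bs → length cs ≡ nb 0 bs → length bs ≡ length u →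
            occurs (bs ++ map (nb 0 bs +_) bs′) (cs ++ cs′) (u ++ v) ≡ occurs bs cs u ∧ occurs bs′ cs′ v
occurs-++ {bs} {cs} bs′ cs′ u v rgs-bs ncol-cs len = begin
  occurs (bs ++ map (k +_) bs′) (cs ++ cs′) (u ++ v)
    ≡⟨ occurs≡ (bs ++ map (k +_) bs′) (cs ++ cs′) (u ++ v) ⟩
  (length (bs ++ map (k +_) bs′) ≡ᵇ length (u ++ v)) ∧
  occursPairs (cs ++ cs′) (zip (bs ++ map (k +_) bs′) (u ++ v))
    ≡⟨ cong₂ _∧_ lengths pairs ⟩
  (length bs′ ≡ᵇ length v) ∧ (occursPairs cs (zip bs u) ∧ occursPairs cs′ (zip bs′ v))
    ≡⟨ ∧.x∙yz≈y∙xz (length bs′ ≡ᵇ length v) (occursPairs cs (zip bs u)) _ ⟩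
  occursPairs cs (zip bs u) ∧ ((length bs′ ≡ᵇ length v) ∧ occursPairs cs′ (zip bs′ v))
    ≡⟨ cong₂ _∧_ (sym (length≡⇒occurs≡occursPairs bs cs u len)) (sym (occurs≡ bs′ cs′ v)) ⟩
  occurs bs cs u ∧ occurs bs′ cs′ v ∎
  where
  open ≡-Reasoning
  k = nb 0 bs
  lengths : (length (bs ++ map (k +_) bs′) ≡ᵇ length (u ++ v)) ≡ (length bs′ ≡ᵇ length v)
  lengths rewrite length-++ bs {map (k +_) bs′} | length-++ u {v} | length-map (k +_) bs′ | len =
    +-cancelˡ-≡ᵇ (length u) (length bs′) (length v)
  pairs : occursPairs (cs ++ cs′) (zip (bs ++ map (k +_) bs′) (u ++ v)) ≡
          occursPairs cs (zip bs u) ∧ occursPairs cs′ (zip bs′ v)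
  pairs rewrite zip-++ bs u {map (k +_) bs′} {v} len | zip-mapˡ (k +_) bs′ v | sym ncol-cs =
    occursPairs-++ cs cs′ (zip bs u) (zip bs′ v)
      (λ p∈ → subst (_ <_) (sym ncol-cs) (RGS-label<nb rgs-bs (∈-zip⁻ˡ p∈)))

-- Colours are at least 1 and (m , x) is a letter of 𝔸_{m+1}: block b gets
-- the b-th letter of the alphabet of its colour.
blockLetter : List ℕ → ℕ → Letter
blockLetter cs b = (nth cs b ∸ 1 , b)

canonicalWord : ∀ {a} → CP a → Word
canonicalWord Π = map (blockLetter (colors Π)) (blocks Π)

ColorsOK⇒positive : ∀ {a bs k cs b} → ColorsOK a bs k cs → b < length cs → 1 ≤ nth cs b
ColorsOK⇒positive {cs = c ∷ cs} {zero} ((1≤c , _) , _) _ = 1≤c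
ColorsOK⇒positive {cs = c ∷ cs} {suc b} (_ , ok) (s≤s b<) = ColorsOK⇒positive ok b<

occurs-canonicalWord : ∀ {a} (Π : CP a) → occurs (blocks Π) (colors Π) (canonicalWord Π) ≡ true
occurs-canonicalWord Π = begin
  occurs bs cs (map letter bs)
    ≡⟨ length≡⇒occurs≡occursPairs bs cs _ (sym (length-map letter bs)) ⟩
  occursPairs cs (zip bs (map letter bs))
    ≡⟨ cong (occursPairs cs) (zip-mapʳ letter bs bs) ⟩
  occursPairs cs (map (map₂ letter) (zip bs bs))
    ≡⟨ cong₂ _∧_ colours consistency ⟩
  true ∎
  where
  open ≡-Reasoning
  bs = blocks Π
  cs = colors Π
  letter = blockLetter cs
  colours : allB (colourMatches cs) (map (map₂ letter) (zip bs bs)) ≡ true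
  colours = trans (allB-map _ _ (zip bs bs)) (allB⁺ matches)
    where
    matches : ∀ {p} → p ∈ zip bs bs → colourMatches cs (map₂ letter p) ≡ true
    matches {x , y} p∈ with ∈-zip-diag⁻ p∈
    ... | refl = trans (cong (nth cs x ≡ᵇ_) (suc[n∸1]≡n positive)) (≡ᵇ-refl (nth cs x))
      where
      positive = ColorsOK⇒positive (colOK Π)
                   (subst (x <_) (sym (ncol Π)) (RGS-label<nb (rgs Π) (∈-zip⁻ˡ p∈)))
  consistency : allB² consistent (map (map₂ letter) (zip bs bs)) ≡ true
  consistency = trans (allB²-map (map₂ letter) (zip bs bs) (λ _ _ → refl)) (allB²⁺ sameLetter)
    where
    sameLetter : ∀ {p q} → p ∈ zip bs bs → q ∈ zip bs bs →
                 consistent (map₂ letter p) (map₂ letter q) ≡ true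
    sameLetter {x , _} {y , _} p∈ q∈ with ∈-zip-diag⁻ p∈ | ∈-zip-diag⁻ q∈ | x ≡ᵇ y in x≟y
    ... | refl | refl | false = refl
    ... | refl | refl | true rewrite ≡ᵇ-true⇒≡ x y x≟y = letterEq-refl (letter y)

module _ {a} (Π : CP a) {bs′ cs′} (occ : occurs bs′ cs′ (canonicalWord Π) ≡ true) where

  private
    bs = blocks Π
    letter = blockLetter (colors Π)
    pairs : occursPairs cs′ (map (map₂ letter) (zip bs′ bs)) ≡ true
    pairs = trans (sym (trans (length≡⇒occurs≡occursPairs bs′ cs′ _ (occurs⇒length≡ bs′ cs′ _ occ))
                              (cong (occursPairs cs′) (zip-mapʳ letter bs′ bs))))
                  occ

  canonicalWord-occurs⇒length≡ : length bs′ ≡ length bs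
  canonicalWord-occurs⇒length≡ = trans (occurs⇒length≡ bs′ cs′ _ occ) (length-map letter bs)

  canonicalWord-occurs⇒functional : Functional (zip bs′ bs)
  canonicalWord-occurs⇒functional {x} {y} {z} xy∈ xz∈
    with allB²⁻ {r = consistent} (∧-true⇒ʳ pairs)
                (∈-map⁺ (map₂ letter) xy∈) (∈-map⁺ (map₂ letter) xz∈)
  ... | e rewrite ≡ᵇ-refl x = ≡ᵇ-true⇒≡ y z (∧-true⇒ʳ e)

  canonicalWord-occurs⇒colours : ∀ {x′ x} → (x′ , x) ∈ zip bs′ bs →
                                 nth cs′ x′ ≡ suc (nth (colors Π) x ∸ 1)
  canonicalWord-occurs⇒colours p∈ =
    ≡ᵇ-true⇒≡ _ _ (allB⁻ (∧-true⇒ˡ pairs) (∈-map⁺ (map₂ letter) p∈))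

canonicalWord-occurs⇒ : ∀ {a} (Π : CP a) {bs′ cs′} → RGS 0 bs′ → length cs′ ≡ nb 0 bs′ →
                        occurs bs′ cs′ (canonicalWord Π) ≡ true →
                        (bs′ ≡ blocks Π × cs′ ≡ colors Π) ⊎′ slack 0 bs′ < slack 0 (blocks Π)
canonicalWord-occurs⇒ Π {bs′} {cs′} rgs′ ncol′ occ
  with slack-< 0 (RGS⇒BoundedFrom rgs′ z≤n)
         (functional⇒pointwise-≤ rgs′ (rgs Π) (canonicalWord-occurs⇒length≡ Π {bs′} {cs′} occ)
                                               (canonicalWord-occurs⇒functional Π {bs′} {cs′} occ))
... | inj₂ slack< = inj₂ slack<
... | inj₁ refl = inj₁ (refl , nth-ext (colors Π) cs′ (trans ncol′ (sym (ncol Π))) sameColour)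
  where
  sameColour : ∀ b → b < length (colors Π) → nth cs′ b ≡ nth (colors Π) b
  sameColour b b< = trans (canonicalWord-occurs⇒colours Π {cs′ = cs′} occ (∈-zip-diag⁺ b∈))
                          (suc[n∸1]≡n (ColorsOK⇒positive (colOK Π) b<))
    where
    b∈ = RGS-covers (rgs Π) z≤n (subst (b <_) (ncol Π) b<)

sameCP-refl : ∀ {a} (Π : CP a) → sameCP Π Π ≡ true
sameCP-refl Π rewrite listEq-refl (blocks Π) = listEq-refl (colors Π)

sameCP-comm : ∀ {a} (Π Π′ : CP a) → sameCP Π Π′ ≡ sameCP Π′ Π
sameCP-comm Π Π′ = cong₂ _∧_ (listEq-comm (blocks Π) (blocks Π′)) (listEq-comm (colors Π) (colors Π′))

sameCP⇒≡ : ∀ {a} (Π Π′ : CP a) → sameCP Π Π′ ≡ true →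
           blocks Π ≡ blocks Π′ × colors Π ≡ colors Π′
sameCP⇒≡ Π Π′ e =
  listEq⇒≡ _ _ (∧-true⇒ˡ e) , listEq⇒≡ _ _ (∧-true⇒ʳ {listEq (blocks Π) (blocks Π′)} e)

≡⇒sameCP : ∀ {a} (Π Π′ : CP a) → blocks Π ≡ blocks Π′ → colors Π ≡ colors Π′ →
           sameCP Π Π′ ≡ true
≡⇒sameCP Π Π′ bs≡ cs≡ rewrite bs≡ | cs≡ = sameCP-refl Π′

-- A selector is a property of the underlying data of a colored set partition,
-- so it automatically respects sameCP.
Selector : Set
Selector = List ℕ → List ℕ → Bool

_⊨_ : ∀ {a} → CP a → Selector → Bool
Π ⊨ g = g (blocks Π) (colors Π)

_∧ˢ_ : Selector → Selector → Selector
(g ∧ˢ h) bs cs = g bs cs ∧ h bs cs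

notˢ : Selector → Selector
notˢ g bs cs = not (g bs cs)

is : ∀ {a} → CP a → Selector
is Π bs cs = listEq bs (blocks Π) ∧ listEq cs (colors Π)

occursIn : Word → Selector
occursIn w bs cs = occurs bs cs w

⊨-∧ˢ-is : ∀ {a} (g : Selector) (Π₀ Π : CP a) →
          Π ⊨ (g ∧ˢ is Π₀) ≡ (Π₀ ⊨ g) ∧ sameCP Π Π₀
⊨-∧ˢ-is g Π₀ Π with sameCP Π Π₀ in e
... | true = cong (_∧ true) (cong₂ g (proj₁ (sameCP⇒≡ Π Π₀ e)) (proj₂ (sameCP⇒≡ Π Π₀ e)))
... | false = trans (∧-zeroʳ (Π ⊨ g)) (sym (∧-zeroʳ (Π₀ ⊨ g)))

module _ {c ℓ} (R : CommutativeRing c ℓ) where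

  open CommutativeRing R
    using (Carrier; _≈_; 0#; 1#; setoid; +-cong; +-congˡ; +-identityˡ; +-identityʳ; *-identityʳ;
           zeroˡ; zeroʳ; +-commutativeSemigroup)
    renaming (_+_ to _+ᴿ_; _*_ to _*ᴿ_; refl to ≈-refl; sym to ≈-sym; trans to ≈-trans;
              reflexive to ≈-reflexive)
  open WithRing R using (Series; sumR; _*ˢ_; 1ˢ; Φ; CWSym; coeff; eval)
  open SetoidReasoning setoid

  indicator : Bool → Carrier
  indicator b = if b then 1# else 0#

  indicator-∧ : ∀ a b → indicator a *ᴿ indicator b ≈ indicator (a ∧ b)
  indicator-∧ true true = *-identityʳ 1#
  indicator-∧ true false = zeroʳ 1#
  indicator-∧ false b = zeroˡ (indicator b)

  Φ-∅ : ∀ {a} (w : Word) → Φ (∅ {a}) w ≈ 1ˢ w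
  Φ-∅ [] = ≈-refl
  Φ-∅ (_ ∷ _) = ≈-refl

  Φ-length≢ : ∀ {a} (Π : CP a) {w} → size Π ≢ length w → Φ Π w ≡ 0#
  Φ-length≢ Π {w} ne = cong indicator (length≢⇒occurs≡false (blocks Π) (colors Π) w ne)

  sumR-applyUpTo-zero : ∀ (F : ℕ → Carrier) m → (∀ i → i < m → F i ≈ 0#) →
                        sumR (applyUpTo F m) ≈ 0#
  sumR-applyUpTo-zero F zero _ = ≈-refl
  sumR-applyUpTo-zero F (suc m) F≈0 =
    ≈-trans (+-cong (F≈0 0 (s≤s z≤n))
                    (sumR-applyUpTo-zero (λ i → F (suc i)) m (λ i i< → F≈0 (suc i) (s≤s i<))))
            (+-identityˡ 0#)

  sumR-applyUpTo-single : ∀ (F : ℕ → Carrier) {m n} → n < m →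
                          (∀ i → i < m → i ≢ n → F i ≈ 0#) →
                          sumR (applyUpTo F m) ≈ F n
  sumR-applyUpTo-single F {suc m} {zero} _ F≈0 =
    ≈-trans (+-congˡ (sumR-applyUpTo-zero (λ i → F (suc i)) m (λ i i< → F≈0 (suc i) (s≤s i<) (λ ()))))
            (+-identityʳ (F 0))
  sumR-applyUpTo-single F {suc m} {suc n} (s≤s n<m) F≈0 =
    ≈-trans (+-cong (F≈0 0 (s≤s z≤n) (λ ()))
                    (sumR-applyUpTo-single (λ i → F (suc i)) n<m
                      (λ i i< i≢n → F≈0 (suc i) (s≤s i<) (λ e → i≢n (suc-injective e)))))
            (+-identityˡ (F (suc n)))

  *ˢ≡sumR-applyUpTo : ∀ (f g : Series) w →
    (f *ˢ g) w ≡ sumR (applyUpTo (λ i → f (take i w) *ᴿ g (drop i w)) (suc (length w)))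
  *ˢ≡sumR-applyUpTo f g w = cong sumR (map-applyUpTo id (λ i → f (take i w) *ᴿ g (drop i w)) (suc (length w)))

  Φ-*ˢ-off-split : ∀ {a} (Π Π′ : CP a) w {i} → i ≤ length w → i ≢ size Π →
                   Φ Π (take i w) *ᴿ Φ Π′ (drop i w) ≈ 0#
  Φ-*ˢ-off-split Π Π′ w {i} i≤ i≢n = begin
    Φ Π (take i w) *ᴿ Φ Π′ (drop i w)
      ≡⟨ cong (_*ᴿ Φ Π′ (drop i w)) (Φ-length≢ Π (λ e → i≢n (sym (trans e (length-take-≤ i≤))))) ⟩
    0# *ᴿ Φ Π′ (drop i w)
      ≈⟨ zeroˡ _ ⟩
    0# ∎

  Φ-*ˢ : ∀ {a} (Π Π′ : CP a) w → (Φ Π *ˢ Φ Π′) w ≈ Φ (Π ⊎ Π′) w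
  Φ-*ˢ Π Π′ w with size Π ≤? length w
  ... | yes n≤ = begin
    (Φ Π *ˢ Φ Π′) w
      ≡⟨ *ˢ≡sumR-applyUpTo (Φ Π) (Φ Π′) w ⟩
    sumR (applyUpTo (λ i → Φ Π (take i w) *ᴿ Φ Π′ (drop i w)) (suc (length w)))
      ≈⟨ sumR-applyUpTo-single _ (s≤s n≤) (λ i i< → Φ-*ˢ-off-split Π Π′ w (≤-pred i<)) ⟩
    indicator (occurs bs cs (take n w)) *ᴿ indicator (occurs bs′ cs′ (drop n w))
      ≈⟨ indicator-∧ _ _ ⟩
    indicator (occurs bs cs (take n w) ∧ occurs bs′ cs′ (drop n w))
      ≡⟨ cong indicator (sym (occurs-++ {cs = cs} bs′ cs′ (take n w) (drop n w)
                                        (rgs Π) (ncol Π) (sym (length-take-≤ n≤)))) ⟩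
    Φ (Π ⊎ Π′) (take n w ++ drop n w)
      ≡⟨ cong (Φ (Π ⊎ Π′)) (take++drop≡id n w) ⟩
    Φ (Π ⊎ Π′) w ∎
    where
    bs = blocks Π
    cs = colors Π
    bs′ = blocks Π′
    cs′ = colors Π′
    n = size Π
  ... | no n≰ = begin
    (Φ Π *ˢ Φ Π′) w
      ≡⟨ *ˢ≡sumR-applyUpTo (Φ Π) (Φ Π′) w ⟩
    sumR (applyUpTo (λ i → Φ Π (take i w) *ᴿ Φ Π′ (drop i w)) (suc (length w)))
      ≈⟨ sumR-applyUpTo-zero _ _ allOff ⟩
    0#
      ≡⟨ sym (Φ-length≢ (Π ⊎ Π′) tooLong) ⟩
    Φ (Π ⊎ Π′) w ∎
    where
    allOff : ∀ i → i < suc (length w) → Φ Π (take i w) *ᴿ Φ Π′ (drop i w) ≈ 0#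
    allOff i i< = Φ-*ˢ-off-split Π Π′ w i≤ (λ i≡n → n≰ (subst (_≤ length w) i≡n i≤))
      where
      i≤ = ≤-pred i<
    tooLong : size (Π ⊎ Π′) ≢ length w
    tooLong e = n≰ (≤-trans (m≤m+n (size Π) _) (≤-reflexive (trans (sym (length-++ (blocks Π))) e)))

  _when_ : Carrier → Bool → Carrier
  r when b = if b then r else 0#

  selectedSum : ∀ {a} → Selector → CWSym a → Carrier
  selectedSum g [] = 0#
  selectedSum g ((r , Π) ∷ xs) = r when (Π ⊨ g) +ᴿ selectedSum g xs

  coeff≡selectedSum : ∀ {a} (x : CWSym a) Π → coeff x Π ≡ selectedSum (is Π) x
  coeff≡selectedSum [] Π = refl
  coeff≡selectedSum ((r , Π′) ∷ xs) Π = cong (_ +ᴿ_) (coeff≡selectedSum xs Π)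

  eval≈selectedSum : ∀ {a} (x : CWSym a) w → eval x w ≈ selectedSum (occursIn w) x
  eval≈selectedSum [] w = ≈-refl
  eval≈selectedSum ((r , Π) ∷ xs) w = +-cong (scale (occurs (blocks Π) (colors Π) w)) (eval≈selectedSum xs w)
    where
    scale : ∀ b → r *ᴿ indicator b ≈ r when b
    scale true = *-identityʳ r
    scale false = zeroʳ r

  selectedSum-cong : ∀ {a} {g h : Selector} (x : CWSym a) → (∀ (Π : CP a) → Π ⊨ g ≡ Π ⊨ h) →
                     selectedSum g x ≡ selectedSum h x
  selectedSum-cong [] _ = refl
  selectedSum-cong ((r , Π) ∷ xs) g≡h = cong₂ (λ b s → r when b +ᴿ s) (g≡h Π) (selectedSum-cong xs g≡h)

  selectedSum-split : ∀ {a} (g h : Selector) (x : CWSym a) →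
                      selectedSum g x ≈ selectedSum (g ∧ˢ h) x +ᴿ selectedSum (g ∧ˢ notˢ h) x
  selectedSum-split g h [] = ≈-sym (+-identityˡ 0#)
  selectedSum-split g h ((r , Π) ∷ xs) =
    ≈-trans (+-cong (split (Π ⊨ g) (Π ⊨ h)) (selectedSum-split g h xs)) (+ᴿ.interchange _ _ _ _)
    where
    module +ᴿ = CommutativeSemigroupProperties +-commutativeSemigroup
    split : ∀ b b′ → r when b ≈ r when (b ∧ b′) +ᴿ r when (b ∧ not b′)
    split true true = ≈-sym (+-identityʳ r)
    split true false = ≈-sym (+-identityˡ r)
    split false _ = ≈-sym (+-identityˡ 0#)

  selectedSum-never : ∀ {a} (x : CWSym a) → selectedSum (λ _ _ → false) x ≈ 0#
  selectedSum-never [] = ≈-refl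
  selectedSum-never ((r , Π) ∷ xs) = ≈-trans (+-congˡ (selectedSum-never xs)) (+-identityˡ 0#)

  selectedSum-∧ˢ-is : ∀ {a} (g : Selector) (x : CWSym a) Π₀ → Π₀ ⊨ g ≡ true →
                      selectedSum (g ∧ˢ is Π₀) x ≡ coeff x Π₀
  selectedSum-∧ˢ-is g x Π₀ e =
    trans (selectedSum-cong {g = g ∧ˢ is Π₀} {is Π₀} x
                            (λ Π → trans (⊨-∧ˢ-is g Π₀ Π) (cong (_∧ sameCP Π Π₀) e)))
          (sym (coeff≡selectedSum x Π₀))

  selectedSum-∧ˢ-is-false : ∀ {a} (g : Selector) (x : CWSym a) Π₀ → Π₀ ⊨ g ≡ false →
                            selectedSum (g ∧ˢ is Π₀) x ≈ 0#
  selectedSum-∧ˢ-is-false g x Π₀ e =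
    ≈-trans (≈-reflexive (selectedSum-cong {g = g ∧ˢ is Π₀} {λ _ _ → false} x
                            (λ Π → trans (⊨-∧ˢ-is g Π₀ Π) (cong (_∧ sameCP Π Π₀) e))))
            (selectedSum-never x)

  -- The entries of x may repeat a partition, so vanishing of coeff x is only
  -- used after regrouping: split off all entries equal to the head Π₀.
  selectedSum-vanishes : ∀ {a} (g : Selector) (x : CWSym a) →
                         (∀ Π → Π ⊨ g ≡ true → coeff x Π ≈ 0#) → selectedSum g x ≈ 0#
  selectedSum-vanishes g [] _ = ≈-refl
  selectedSum-vanishes g x@((r , Π₀) ∷ xs) coeff≈0 = begin
    selectedSum g x                                   ≈⟨ selectedSum-split g (is Π₀) x ⟩
    selectedSum (g ∧ˢ is Π₀) x +ᴿ selectedSum g′ x    ≈⟨ +-cong atΠ₀ awayFromΠ₀ ⟩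
    0# +ᴿ 0#                                          ≈⟨ +-identityˡ 0# ⟩
    0#                                                ∎
    where
    atΠ₀ : selectedSum (g ∧ˢ is Π₀) x ≈ 0#
    atΠ₀ = byCase (Π₀ ⊨ g) refl
      where
      byCase : ∀ b → Π₀ ⊨ g ≡ b → selectedSum (g ∧ˢ is Π₀) x ≈ 0#
      byCase true e = ≈-trans (≈-reflexive (selectedSum-∧ˢ-is g x Π₀ e)) (coeff≈0 Π₀ e)
      byCase false e = selectedSum-∧ˢ-is-false g x Π₀ e
    g′ = g ∧ˢ notˢ (is Π₀)
    headVanishes : Π₀ ⊨ g′ ≡ false
    headVanishes rewrite sameCP-refl Π₀ = ∧-zeroʳ (Π₀ ⊨ g)
    coeff-xs≈0 : ∀ Π → Π ⊨ g′ ≡ true → coeff xs Π ≈ 0#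
    coeff-xs≈0 Π e = begin
      coeff xs Π              ≈⟨ +-identityˡ _ ⟨
      0# +ᴿ coeff xs Π        ≡⟨ cong (λ b → r when b +ᴿ coeff xs Π) Π₀≠Π ⟨
      coeff x Π               ≈⟨ coeff≈0 Π (∧-true⇒ˡ e) ⟩
      0#                      ∎
      where
      Π₀≠Π : sameCP Π₀ Π ≡ false
      Π₀≠Π = trans (sameCP-comm Π₀ Π) (not-true⇒false (∧-true⇒ʳ {Π ⊨ g} e))
    awayFromΠ₀ : selectedSum g′ x ≈ 0#
    awayFromΠ₀ = begin
      selectedSum g′ x        ≡⟨ cong (λ b → r when b +ᴿ selectedSum g′ xs) headVanishes ⟩
      0# +ᴿ selectedSum g′ xs ≈⟨ +-identityˡ _ ⟩
      selectedSum g′ xs       ≈⟨ selectedSum-vanishes g′ xs coeff-xs≈0 ⟩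
      0#                      ∎

  linearIndependence : ∀ {a} (x : CWSym a) → (∀ w → eval x w ≈ 0#) → ∀ Π → coeff x Π ≈ 0#
  linearIndependence x eval≈0 =
    All.wfRec (wellFounded-on (λ Π → slack 0 (blocks Π)) <-wellFounded) _ (λ Π → coeff x Π ≈ 0#) step
    where
    step : ∀ Π → (∀ {Π′} → slack 0 (blocks Π′) < slack 0 (blocks Π) → coeff x Π′ ≈ 0#) →
           coeff x Π ≈ 0#
    step Π ih = begin
      coeff x Π                                     ≡⟨ selectedSum-∧ˢ-is occ x Π (occurs-canonicalWord Π) ⟨
      selectedSum (occ ∧ˢ is Π) x                   ≈⟨ +-identityʳ _ ⟨
      selectedSum (occ ∧ˢ is Π) x +ᴿ 0#             ≈⟨ +-congˡ (selectedSum-vanishes _ x finer) ⟨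
      selectedSum (occ ∧ˢ is Π) x +ᴿ selectedSum (occ ∧ˢ notˢ (is Π)) x
                                                    ≈⟨ selectedSum-split occ (is Π) x ⟨
      selectedSum occ x                             ≈⟨ eval≈selectedSum x w ⟨
      eval x w                                      ≈⟨ eval≈0 w ⟩
      0#                                            ∎
      where
      w = canonicalWord Π
      occ = occursIn w
      finer : ∀ Π′ → Π′ ⊨ (occ ∧ˢ notˢ (is Π)) ≡ true → coeff x Π′ ≈ 0#
      finer Π′ e with canonicalWord-occurs⇒ Π (rgs Π′) (ncol Π′) (∧-true⇒ˡ e)
      ... | inj₂ slack< = ih slack<
      ... | inj₁ (bs≡ , cs≡)
        with trans (sym (not-true⇒false (∧-true⇒ʳ {Π′ ⊨ occ} e))) (≡⇒sameCP Π′ Π bs≡ cs≡)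
      ...   | ()

mainTheorem1 : ∀ {c ℓ} (R : CommutativeRing c ℓ) (a : ℕ → ℕ) →
    let open WithRing R in
    ((w : Word) → Φ (∅ {a}) w ≈ 1ˢ w)
    × ((Π Π′ : CP a) (w : Word) → (Φ Π *ˢ Φ Π′) w ≈ Φ (Π ⊎ Π′) w)
    × ((x : CWSym a) → ((w : Word) → eval x w ≈ 0#) → (Π : CP a) → coeff x Π ≈ 0#)
mainTheorem1 R a = Φ-∅ R {a} , Φ-*ˢ R , linearIndependence R
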